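{- Let $P$ be an integer such that $P^2+4$ is square-free, let $m\ge 0$ be an integer, and let $\sigma_2(n)=\sum_{d\mid n} d^2$ (sum over positive divisors). Then, apart from finitely many (computable) solutions, all of which satisfy $n\le \big(|V_{2m}(P,-1)|+V_{2m}^2(P,-1)-3\big)^3$, every positive integer solution $n$ of $$\sigma_2(n)-n^2=V_{2m}(P,-1)\,n+V_{2m}^2(P,-1)-3$$ is of one of the following forms: (1) $n=V_{2k+1}(P,-1)\,V_{2k+2m+1}(P,-1)$ for some integer $k\ge 0$, with $V_{2k+1}(P,-1)$ and $V_{2k+2m+1}(P,-1)$ both primes; (2) $n=V_{2k+1}(P,-1)\,V_{2m-2k-1}(P,-1)$ for some integer $k\ge 0$ with $2m-2k-1\ge 0$ and $m\neq 2k+1$, with $V_{2k+1}(P,-1)$ and $V_{2m-2k-1}(P,-1)$ both primes.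
   Context: For integers $P,Q$, the Lucas sequence of the first kind is defined by $U_0(P,Q)=0$, $U_1(P,Q)=1$, $U_n(P,Q)=P\,U_{n-1}(P,Q)-Q\,U_{n-2}(P,Q)$ for $n>1$. The Lucas sequence of the second kind is $V_0(P,Q)=2$, $V_1(P,Q)=P$, $V_n(P,Q)=P\,V_{n-1}(P,Q)-Q\,V_{n-2}(P,Q)$ for $n>1$. -}

module Defs where

open import Data.Nat as ℕ using (ℕ; zero; suc)
open import Data.Nat.Divisibility using (_∣_; _∣?_)
open import Data.List using (List; map; filter; upTo)
open import Data.Nat.ListAction using (sum)
open import Data.Integer as ℤ using (ℤ; +_; ∣_∣)
open import Relation.Binary.PropositionalEquality using (_≡_)

V : ℤ → ℤ → ℕ → ℤ
V P Q zero = + 2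
V P Q (suc zero) = P
V P Q (suc (suc n)) = P ℤ.* V P Q (suc n) ℤ.- Q ℤ.* V P Q n

U : ℤ → ℤ → ℕ → ℤ
U P Q zero = + 0
U P Q (suc zero) = + 1
U P Q (suc (suc n)) = P ℤ.* U P Q (suc n) ℤ.- Q ℤ.* U P Q n

σ₂ : ℕ → ℕ
σ₂ n = sum (map (λ d → d ℕ.* d) (filter (λ d → d ∣? n) (map suc (upTo n))))

SquareFree : ℕ → Set
SquareFree n = ∀ d → d ℕ.* d ∣ n → d ≡ 1

SquareFreeℤ : ℤ → Set
SquareFreeℤ z = SquareFree ∣ z ∣

-- Put a = V_{2m}(P, -1), so that a = V_{2m}(|P|, -1) ≥ 2. Beyond the bound, write n = e d with d
-- the least prime factor of n. Since σ₂ n ≥ 1 + e² + n², the equation gives e² + 4 ≤ a n + a²,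
-- which is incompatible with d² ≤ e; hence e is prime, and as n = p and n = p² are not solutions,
-- n = p q with primes p < q satisfying p² + q² + 4 = a p q + a². The other root a p - q of this
-- quadratic in q would be at least q, so s = 2 q - a p is positive and s² = (a² - 4)(p² + 4) =
-- D U_{2m}² (p² + 4) with D = P² + 4. As D is square-free, p² + 4 = D w², and a descent along the
-- Cassini identities shows (p , w) = (V_{2k+1} , U_{2k+1}); then 2 q = a p + s = 2 V_{2k+2m+1}.
-- So only form (1) occurs.
module Submission where

open import Defs
open import Data.Nat as ℕ
open import Data.Nat.Properties
open import Data.Nat.Divisibility
open import Data.Nat.Primality using (Prime; _Rough_; 2-rough; ∤⇒rough-suc; rough∧∣⇒rough; rough∧∣⇒prime; rough⇒≤; rough∧square>⇒prime; prime[2]; euclidsLemma; prime⇒irreducible; prime⇒nonZero; prime⇒nonTrivial)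
open import Data.Nat.DivMod using (_/_; m/n*n≡m)
open import Data.Nat.GCD using (gcd; gcd[m,n]∣m; gcd[m,n]∣n; gcd[m,n]≢0)
open import Data.Nat.Coprimality as Coprime using (Coprime; coprime-divisor; coprime-/gcd)
open import Data.Nat.Tactic.RingSolver using (solve; solve-∀)
open import Data.List using (List; _∷_; []; [_]; _++_; _∷ʳ_; map; filter; upTo)
open import Data.List.Properties using (map-++; filter-++; filter-accept; filter-reject; upTo-∷ʳ)
open import Data.Nat.ListAction using (sum)
open import Data.Nat.ListAction.Properties using (sum-++)
open import Data.Product using (proj₁; proj₂; uncurry; Σ; ∃-syntax; _×_; _,_)
open import Data.Sum using (_⊎_; inj₁; inj₂)
open import Data.Empty using (⊥; ⊥-elim)
open import Relation.Nullary using (¬_; yes; no)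
open import Function using (_∘_)
open import Data.Integer as ℤ using (ℤ; +_; -[1+_]; ∣_∣; -1ℤ; 1ℤ)
import Data.Integer.Properties as ℤ
open import Data.Integer.Tactic.RingSolver using () renaming (solve-∀ to solveℤ-∀)
open import Relation.Binary.PropositionalEquality hiding ([_])

-- V⁺ x n = V_n(x, -1) and U⁺ x n = U_n(x, -1) for natural x; for an integer P,
-- V_n(P, -1) is ± V⁺ ∣P∣ n.
V⁺ : ℕ → ℕ → ℕ
V⁺ x 0 = 2
V⁺ x 1 = x
V⁺ x (suc (suc n)) = x * V⁺ x (suc n) + V⁺ x n

U⁺ : ℕ → ℕ → ℕ
U⁺ x 0 = 0
U⁺ x 1 = 1
U⁺ x (suc (suc n)) = x * U⁺ x (suc n) + U⁺ x n

Δ : ℕ → ℕ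
Δ x = x * x + 4

module _ where
  open ≡-Reasoning

  V-recurrence : ∀ P A B → P ℤ.* A ℤ.- -1ℤ ℤ.* B ≡ P ℤ.* A ℤ.+ B
  V-recurrence P A B = cong (λ t → P ℤ.* A ℤ.+ t) (trans (cong ℤ.-_ (ℤ.-1*i≡-i B)) (ℤ.neg-involutive B))

  V-pos : ∀ x n → V (+ x) -1ℤ n ≡ + V⁺ x n
  V-pos x zero          = refl
  V-pos x (suc zero)    = refl
  V-pos x (suc (suc n)) = begin
    + x ℤ.* V (+ x) -1ℤ (suc n) ℤ.- -1ℤ ℤ.* V (+ x) -1ℤ n  ≡⟨ cong₂ (λ u v → + x ℤ.* u ℤ.- -1ℤ ℤ.* v) (V-pos x (suc n)) (V-pos x n) ⟩
    + x ℤ.* + V⁺ x (suc n) ℤ.- -1ℤ ℤ.* + V⁺ x n            ≡⟨ V-recurrence (+ x) _ _ ⟩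
    + x ℤ.* + V⁺ x (suc n) ℤ.+ + V⁺ x n                    ≡⟨ cong (ℤ._+ + V⁺ x n) (ℤ.pos-* x (V⁺ x (suc n))) ⟨
    + (x * V⁺ x (suc n)) ℤ.+ + V⁺ x n                      ≡⟨ ℤ.pos-+ (x * V⁺ x (suc n)) (V⁺ x n) ⟨
    + V⁺ x (suc (suc n))                                    ∎

  V-neg : ∀ P n → V (ℤ.- P) -1ℤ n ≡ -1ℤ ℤ.^ n ℤ.* V P -1ℤ n
  V-neg P zero          = refl
  V-neg P (suc zero)    = trans (sym (ℤ.-1*i≡-i P)) (cong (ℤ._* P) (sym (ℤ.*-identityʳ -1ℤ)))
  V-neg P (suc (suc n)) = begin
    ℤ.- P ℤ.* V (ℤ.- P) -1ℤ (suc n) ℤ.- -1ℤ ℤ.* V (ℤ.- P) -1ℤ n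
      ≡⟨ cong₂ (λ u v → ℤ.- P ℤ.* u ℤ.- -1ℤ ℤ.* v) (V-neg P (suc n)) (V-neg P n) ⟩
    ℤ.- P ℤ.* (-1ℤ ℤ.* s ℤ.* V P -1ℤ (suc n)) ℤ.- -1ℤ ℤ.* (s ℤ.* V P -1ℤ n)
      ≡⟨ flip-sign P s (V P -1ℤ (suc n)) (V P -1ℤ n) ⟩
    -1ℤ ℤ.* (-1ℤ ℤ.* s) ℤ.* (P ℤ.* V P -1ℤ (suc n) ℤ.- -1ℤ ℤ.* V P -1ℤ n) ∎
    where
    s = -1ℤ ℤ.^ n
    flip-sign : ∀ P s A B → ℤ.- P ℤ.* (-1ℤ ℤ.* s ℤ.* A) ℤ.- -1ℤ ℤ.* (s ℤ.* B)
                          ≡ -1ℤ ℤ.* (-1ℤ ℤ.* s) ℤ.* (P ℤ.* A ℤ.- -1ℤ ℤ.* B)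
    flip-sign = solveℤ-∀

  -1^even : ∀ t → -1ℤ ℤ.^ (2 * t) ≡ 1ℤ
  -1^even t = trans (sym (ℤ.^-*-assoc -1ℤ 2 t)) (ℤ.^-zeroˡ t)

  ∣-1^n*i∣ : ∀ n i → ∣ -1ℤ ℤ.^ n ℤ.* i ∣ ≡ ∣ i ∣
  ∣-1^n*i∣ zero    i = cong ∣_∣ (ℤ.*-identityˡ i)
  ∣-1^n*i∣ (suc n) i = begin
    ∣ -1ℤ ℤ.* -1ℤ ℤ.^ n ℤ.* i ∣     ≡⟨ cong ∣_∣ (trans (ℤ.*-assoc -1ℤ (-1ℤ ℤ.^ n) i) (ℤ.-1*i≡-i (-1ℤ ℤ.^ n ℤ.* i))) ⟩
    ∣ ℤ.- (-1ℤ ℤ.^ n ℤ.* i) ∣       ≡⟨ ℤ.∣-i∣≡∣i∣ (-1ℤ ℤ.^ n ℤ.* i) ⟩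
    ∣ -1ℤ ℤ.^ n ℤ.* i ∣             ≡⟨ ∣-1^n*i∣ n i ⟩
    ∣ i ∣                           ∎

  ∣V∣ : ∀ P n → ∣ V P -1ℤ n ∣ ≡ V⁺ ∣ P ∣ n
  ∣V∣ (+ x)    n = cong ∣_∣ (V-pos x n)
  ∣V∣ -[1+ y ] n = trans (cong ∣_∣ (V-neg (+ suc y) n)) (trans (∣-1^n*i∣ n _) (∣V∣ (+ suc y) n))

  V-even : ∀ P m → V P -1ℤ (2 * m) ≡ + V⁺ ∣ P ∣ (2 * m)
  V-even (+ x)    m = V-pos x (2 * m)
  V-even -[1+ y ] m = begin
    V -[1+ y ] -1ℤ (2 * m)                          ≡⟨ V-neg (+ suc y) (2 * m) ⟩
    -1ℤ ℤ.^ (2 * m) ℤ.* V (+ suc y) -1ℤ (2 * m)     ≡⟨ cong (ℤ._* V (+ suc y) -1ℤ (2 * m)) (-1^even m) ⟩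
    1ℤ ℤ.* V (+ suc y) -1ℤ (2 * m)                  ≡⟨ ℤ.*-identityˡ _ ⟩
    V (+ suc y) -1ℤ (2 * m)                         ≡⟨ V-pos (suc y) (2 * m) ⟩
    + V⁺ (suc y) (2 * m)                            ∎

  V-even-product : ∀ P {i j t} → i + j ≡ 2 * t → V P -1ℤ i ℤ.* V P -1ℤ j ≡ + (V⁺ (∣ P ∣) i * V⁺ (∣ P ∣) j)
  V-even-product (+ x) {i} {j} _ = trans (cong₂ ℤ._*_ (V-pos x i) (V-pos x j)) (sym (ℤ.pos-* (V⁺ x i) (V⁺ x j)))
  V-even-product -[1+ y ] {i} {j} {t} i+j≡2t = begin
    V -[1+ y ] -1ℤ i ℤ.* V -[1+ y ] -1ℤ j             ≡⟨ cong₂ ℤ._*_ (V-neg (+ suc y) i) (V-neg (+ suc y) j) ⟩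
    -1ℤ ℤ.^ i ℤ.* A ℤ.* (-1ℤ ℤ.^ j ℤ.* B)             ≡⟨ interchange (-1ℤ ℤ.^ i) (-1ℤ ℤ.^ j) A B ⟩
    -1ℤ ℤ.^ i ℤ.* -1ℤ ℤ.^ j ℤ.* (A ℤ.* B)             ≡⟨ cong (ℤ._* (A ℤ.* B)) (ℤ.^-distribˡ-+-* -1ℤ i j) ⟨
    -1ℤ ℤ.^ (i + j) ℤ.* (A ℤ.* B)                     ≡⟨ cong (λ e → -1ℤ ℤ.^ e ℤ.* (A ℤ.* B)) i+j≡2t ⟩
    -1ℤ ℤ.^ (2 * t) ℤ.* (A ℤ.* B)                     ≡⟨ cong (ℤ._* (A ℤ.* B)) (-1^even t) ⟩
    1ℤ ℤ.* (A ℤ.* B)                                  ≡⟨ ℤ.*-identityˡ _ ⟩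
    A ℤ.* B                                           ≡⟨ V-even-product (+ suc y) {i} {j} {t} i+j≡2t ⟩
    + (V⁺ (suc y) i * V⁺ (suc y) j)                   ∎
    where
    A = V (+ suc y) -1ℤ i
    B = V (+ suc y) -1ℤ j
    interchange : ∀ a b c d → a ℤ.* c ℤ.* (b ℤ.* d) ≡ a ℤ.* b ℤ.* (c ℤ.* d)
    interchange = solveℤ-∀

  ∣P*P+4∣ : ∀ P → ∣ P ℤ.* P ℤ.+ + 4 ∣ ≡ Δ ∣ P ∣
  ∣P*P+4∣ (+ x)    = cong (λ z → ∣ z ℤ.+ + 4 ∣) (ℤ.+◃n≡+n (x * x))
  ∣P*P+4∣ -[1+ y ] = refl

  squareFreeℤ⇒squareFree-Δ : ∀ P → SquareFreeℤ (P ℤ.* P ℤ.+ + 4) → SquareFree (Δ ∣ P ∣)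
  squareFreeℤ⇒squareFree-Δ P = subst SquareFree (∣P*P+4∣ P)

  equation-to-ℕ : ∀ {a n} → + σ₂ n ℤ.- + (n * n) ≡ + a ℤ.* + n ℤ.+ + a ℤ.* + a ℤ.- + 3 →
                  σ₂ n + 3 ≡ n * n + (a * n + a * a)
  equation-to-ℕ {a} {n} eq = ℤ.+-injective (begin
    + (σ₂ n + 3)                                     ≡⟨ ℤ.pos-+ (σ₂ n) 3 ⟩
    + σ₂ n ℤ.+ + 3                                   ≡⟨ shift (+ σ₂ n) (+ (n * n)) (+ 3) ⟩
    + σ₂ n ℤ.- + (n * n) ℤ.+ + (n * n) ℤ.+ + 3       ≡⟨ cong (λ z → z ℤ.+ + (n * n) ℤ.+ + 3) eq ⟩
    Y ℤ.- + 3 ℤ.+ + (n * n) ℤ.+ + 3                  ≡⟨ unshift Y (+ (n * n)) (+ 3) ⟩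
    + (n * n) ℤ.+ Y                                  ≡⟨ cong (λ z → + (n * n) ℤ.+ z) (cong₂ ℤ._+_ (ℤ.pos-* a n) (ℤ.pos-* a a)) ⟨
    + (n * n) ℤ.+ (+ (a * n) ℤ.+ + (a * a))          ≡⟨ cong (λ z → + (n * n) ℤ.+ z) (ℤ.pos-+ (a * n) (a * a)) ⟨
    + (n * n) ℤ.+ + (a * n + a * a)                  ≡⟨ ℤ.pos-+ (n * n) (a * n + a * a) ⟨
    + (n * n + (a * n + a * a))                      ∎)
    where
    Y = + a ℤ.* + n ℤ.+ + a ℤ.* + a
    shift : ∀ S N T → S ℤ.+ T ≡ S ℤ.- N ℤ.+ N ℤ.+ T
    shift = solveℤ-∀
    unshift : ∀ Y N T → Y ℤ.- T ℤ.+ N ℤ.+ T ≡ N ℤ.+ Y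
    unshift = solveℤ-∀

  pos-^ : ∀ t n → + (t ^ n) ≡ (+ t) ℤ.^ n
  pos-^ t zero    = refl
  pos-^ t (suc n) = trans (ℤ.pos-* t (t ^ n)) (cong (+ t ℤ.*_) (pos-^ t n))

  bound-to-ℤ : ∀ {a n} → 2 ≤ a → n ≤ (a + a * a ∸ 3) ^ 3 → + n ℤ.≤ (+ a ℤ.+ + a ℤ.* + a ℤ.- + 3) ℤ.^ 3
  bound-to-ℤ {a} {n} 2≤a n≤t³ =
    subst (λ z → + n ℤ.≤ z ℤ.^ 3) (sym t≡) (subst (+ n ℤ.≤_) (pos-^ (a + a * a ∸ 3) 3) (ℤ.+≤+ n≤t³))
    where
    3≤a+a*a : 3 ≤ a + a * a
    3≤a+a*a = ≤-trans (n≤1+n 3) (≤-trans (*-mono-≤ 2≤a 2≤a) (m≤n+m (a * a) a))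
    t≡ : + a ℤ.+ + a ℤ.* + a ℤ.- + 3 ≡ + (a + a * a ∸ 3)
    t≡ = trans (cong (λ z → + a ℤ.+ z ℤ.- + 3) (sym (ℤ.pos-* a a)))
               (trans (ℤ.m-n≡m⊖n (a + a * a) 3) (ℤ.⊖-≥ 3≤a+a*a))

open ≤-Reasoning

coprime-*ˡ : ∀ {a b c} → Coprime a c → Coprime b c → Coprime (a * b) c
coprime-*ˡ {a} a⊥c b⊥c {i} (i∣ab , i∣c) = b⊥c (coprime-divisor i⊥a i∣ab , i∣c)
  where
  i⊥a : Coprime i a
  i⊥a (j∣i , j∣a) = a⊥c (j∣a , ∣-trans j∣i i∣c)

coprime-squares : ∀ {a b} → Coprime a b → Coprime (a * a) (b * b)
coprime-squares a⊥b = coprime-*ˡ a⊥b² a⊥b²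
  where
  a⊥b² = Coprime.sym (coprime-*ˡ (Coprime.sym a⊥b) (Coprime.sym a⊥b))

-- Divide out g = gcd u r: then (u/g)² divides D (r/g)² with u/g, r/g coprime, so (u/g)² ∣ D.
squareFree-sq∣⇒∣ : ∀ {D u r} → SquareFree D → u ≢ 0 → u * u ∣ D * (r * r) → u ∣ r
squareFree-sq∣⇒∣ {D} {u} {r} sf u≢0 u²∣Dr² = subst (_∣ r) g≡u (gcd[m,n]∣n u r)
  where
  g = gcd u r
  instance
    _ = ≢-nonZero (gcd[m,n]≢0 u r (inj₁ u≢0))
    _ = m*n≢0 g g
  u′ = u / g
  r′ = r / g
  u≡ : u′ * g ≡ u
  u≡ = m/n*n≡m (gcd[m,n]∣m u r)
  r≡ : r′ * g ≡ r
  r≡ = m/n*n≡m (gcd[m,n]∣n u r)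
  u′²g²∣r′²Dg² : u′ * u′ * (g * g) ∣ r′ * r′ * D * (g * g)
  u′²g²∣r′²Dg² = subst₂ _∣_
    (trans (cong (λ t → t * t) (sym u≡)) (square-* u′ g))
    (trans (cong (λ t → D * (t * t)) (sym r≡)) (D*square-* r′ g))
    u²∣Dr²
    where
    square-* : ∀ a b → a * b * (a * b) ≡ a * a * (b * b)
    square-* a b = solve (a ∷ b ∷ [])
    D*square-* : ∀ a b → D * (a * b * (a * b)) ≡ a * a * D * (b * b)
    D*square-* a b = solve (D ∷ a ∷ b ∷ [])
  u′≡1 : u′ ≡ 1
  u′≡1 = sf u′ (coprime-divisor (coprime-squares (coprime-/gcd u r)) (*-cancelʳ-∣ (g * g) u′²g²∣r′²Dg²))
  g≡u : g ≡ u
  g≡u = trans (sym (*-identityˡ g)) (trans (cong (_* g) (sym u′≡1)) u≡)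

square≡0⇒≡0 : ∀ {s} → s * s ≡ 0 → s ≡ 0
square≡0⇒≡0 {s} s²≡0 with m*n≡0⇒m≡0∨n≡0 s s²≡0
... | inj₁ s≡0 = s≡0
... | inj₂ s≡0 = s≡0

module _ {D c N : ℕ} (sf : SquareFree D) where

  private
    Root : ℕ → Set
    Root s = s * s ≡ D * (c * c) * N

  root-factors≢0 : ∀ {s} → s ≢ 0 → Root s → D ≢ 0 × c ≢ 0
  root-factors≢0 {s} s≢0 s²≡ = D≢0 , c≢0
    where
    D≢0 : D ≢ 0
    D≢0 refl = s≢0 (square≡0⇒≡0 s²≡)
    c≢0 : c ≢ 0
    c≢0 refl = s≢0 (square≡0⇒≡0 (trans s²≡ (cong (_* N) (*-zeroʳ D))))

  D∣root : ∀ {s} → D ≢ 0 → Root s → D ∣ s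
  D∣root D≢0 s²≡ = squareFree-sq∣⇒∣ sf D≢0 (divides (c * c * N) (trans (cong (D *_) s²≡) (solve (D ∷ c ∷ N ∷ []))))

  c∣root/D : ∀ {t} → D ≢ 0 → c ≢ 0 → Root (t * D) → c ∣ t
  c∣root/D {t} D≢0 c≢0 s²≡ = squareFree-sq∣⇒∣ sf c≢0 (divides N (*-cancelˡ-≡ _ _ D {{≢-nonZero D≢0}} (begin-equality
    D * (D * (t * t))   ≡⟨ solve (D ∷ t ∷ []) ⟩
    t * D * (t * D)     ≡⟨ s²≡ ⟩
    D * (c * c) * N     ≡⟨ solve (D ∷ c ∷ N ∷ []) ⟩
    D * (N * (c * c))   ∎)))

  root-cofactor : ∀ {w} → D ≢ 0 → c ≢ 0 → Root (w * c * D) → N ≡ D * (w * w)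
  root-cofactor {w} D≢0 c≢0 s²≡ = *-cancelˡ-≡ N (D * (w * w)) (D * (c * c)) {{Dc²≢0}} (begin-equality
    D * (c * c) * N                 ≡⟨ s²≡ ⟨
    w * c * D * (w * c * D)         ≡⟨ solve (w ∷ c ∷ D ∷ []) ⟩
    D * (c * c) * (D * (w * w))     ∎)
    where
    instance
      D-nonZero = ≢-nonZero D≢0
      c-nonZero = ≢-nonZero c≢0
    Dc²≢0 = m*n≢0 D (c * c) {{D-nonZero}} {{m*n≢0 c c}}

  squareFree-sq-split : ∀ {s} → s ≢ 0 → Root s → ∃[ w ] N ≡ D * (w * w) × s ≡ D * c * w
  squareFree-sq-split {s} s≢0 s²≡ = divide-c (D∣root {s} D≢0 s²≡)
    where
    D≢0 = proj₁ (root-factors≢0 {s} s≢0 s²≡)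
    c≢0 = proj₂ (root-factors≢0 {s} s≢0 s²≡)
    divide-c : D ∣ s → ∃[ w ] N ≡ D * (w * w) × s ≡ D * c * w
    divide-c (divides t s≡tD) = conclude (c∣root/D {t} D≢0 c≢0 (subst Root s≡tD s²≡))
      where
      conclude : c ∣ t → ∃[ w ] N ≡ D * (w * w) × s ≡ D * c * w
      conclude (divides w t≡wc) =
        w , root-cofactor {w} D≢0 c≢0 (subst Root s≡wcD s²≡) , trans s≡wcD (solve (w ∷ c ∷ D ∷ []))
        where
        s≡wcD = trans s≡tD (cong (_* D) t≡wc)

even-square⇒even : ∀ {y} → 2 ∣ y * y → 2 ∣ y
even-square⇒even {y} 2∣y² with euclidsLemma y y prime[2] 2∣y²
... | inj₁ 2∣y = 2∣y
... | inj₂ 2∣y = 2∣y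

-- The second root of  X² - a p X + (p² + 4 - a²) = 0  is  a p - q ≥ q  unless a p < 2 q.
other-root-large : ∀ {a p q} → 2 ≤ a → p < q → p * p + q * q + 4 ≡ a * (p * q) + a * a → a * p < 2 * q
other-root-large {a} {p} {q} 2≤a p<q eq = ≰⇒> λ 2q≤ap → uncurry other-root (m≤n⇒∃[o]m+o≡n 2q≤ap)
  where
  other-root : ∀ r → 2 * q + r ≡ a * p → ⊥
  other-root r 2q+r≡ap = <-irrefl p²+4≡ (+-mono-<-≤ (*-mono-< (<-≤-trans p<q (m≤m+n q r)) p<q) (*-mono-≤ 2≤a 2≤a))
    where
    p²+4≡ : p * p + 4 ≡ (q + r) * q + a * a
    p²+4≡ = +-cancelˡ-≡ (q * q) _ _ (begin-equality
      q * q + (p * p + 4)             ≡⟨ solve (p ∷ q ∷ []) ⟩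
      p * p + q * q + 4               ≡⟨ eq ⟩
      a * (p * q) + a * a             ≡⟨ cong (_+ a * a) (*-assoc a p q) ⟨
      a * p * q + a * a               ≡⟨ cong (λ t → t * q + a * a) 2q+r≡ap ⟨
      (2 * q + r) * q + a * a         ≡⟨ solve (a ∷ q ∷ r ∷ []) ⟩
      q * q + ((q + r) * q + a * a)   ∎)

discriminant : ∀ {a p q s K} → p * p + q * q + 4 ≡ a * (p * q) + a * a → 2 * q ≡ a * p + s →
               a * a ≡ K + 4 → s * s ≡ K * (p * p + 4)
discriminant {a} {p} {q} {s} {K} eq 2q≡ a²≡ = +-cancelˡ-≡ (4 * (p * p) + 16) _ _ (begin-equality
  4 * (p * p) + 16 + s * s          ≡⟨ +-cancelˡ-≡ (a * a * (p * p) + 2 * a * p * s) _ _ cleared ⟩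
  a * a * (p * p) + 4 * (a * a)     ≡⟨ cong (λ t → t * (p * p) + 4 * t) a²≡ ⟩
  (K + 4) * (p * p) + 4 * (K + 4)   ≡⟨ solve (K ∷ p ∷ []) ⟩
  4 * (p * p) + 16 + K * (p * p + 4) ∎)
  where
  cleared : a * a * (p * p) + 2 * a * p * s + (4 * (p * p) + 16 + s * s)
          ≡ a * a * (p * p) + 2 * a * p * s + (a * a * (p * p) + 4 * (a * a))
  cleared = begin-equality
    a * a * (p * p) + 2 * a * p * s + (4 * (p * p) + 16 + s * s) ≡⟨ solve (a ∷ p ∷ s ∷ []) ⟩
    4 * (p * p) + (a * p + s) * (a * p + s) + 16                 ≡⟨ cong (λ t → 4 * (p * p) + t * t + 16) 2q≡ ⟨
    4 * (p * p) + 2 * q * (2 * q) + 16                           ≡⟨ solve (p ∷ q ∷ []) ⟩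
    4 * (p * p + q * q + 4)                                      ≡⟨ cong (4 *_) eq ⟩
    4 * (a * (p * q) + a * a)                                    ≡⟨ solve (a ∷ p ∷ q ∷ []) ⟩
    2 * a * p * (2 * q) + 4 * (a * a)                            ≡⟨ cong (λ t → 2 * a * p * t + 4 * (a * a)) 2q≡ ⟩
    2 * a * p * (a * p + s) + 4 * (a * a)                        ≡⟨ solve (a ∷ p ∷ s ∷ []) ⟩
    a * a * (p * p) + 2 * a * p * s + (a * a * (p * p) + 4 * (a * a)) ∎

Cassini⁺ Cassini⁻ : ℕ → ℕ → ℕ → Set
Cassini⁺ x a b = b * b ≡ x * a * b + a * a + 1
Cassini⁻ x a b = b * b + 1 ≡ x * a * b + a * a

module _ (x : ℕ) where

  cassini⁺-step : ∀ {a b} → Cassini⁺ x a b → Cassini⁻ x b (x * b + a)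
  cassini⁺-step {a} {b} h = begin-equality
    (x * b + a) * (x * b + a) + 1                  ≡⟨ solve (x ∷ a ∷ b ∷ []) ⟩
    x * b * (x * b + a) + (x * a * b + a * a + 1)  ≡⟨ cong (λ t → x * b * (x * b + a) + t) h ⟨
    x * b * (x * b + a) + b * b                    ∎

  cassini⁻-step : ∀ {a b} → Cassini⁻ x a b → Cassini⁺ x b (x * b + a)
  cassini⁻-step {a} {b} h = begin-equality
    (x * b + a) * (x * b + a)                      ≡⟨ solve (x ∷ a ∷ b ∷ []) ⟩
    x * b * (x * b + a) + (x * a * b + a * a)      ≡⟨ cong (λ t → x * b * (x * b + a) + t) h ⟨
    x * b * (x * b + a) + (b * b + 1)              ≡⟨ +-assoc _ (b * b) 1 ⟨
    x * b * (x * b + a) + b * b + 1                ∎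

  cassini⁺-unstep : ∀ {a c} → Cassini⁺ x a (x * a + c) → Cassini⁻ x c a
  cassini⁺-unstep {a} {c} h = +-cancelˡ-≡ (x * a * (x * a + c)) _ _ (begin-equality
    x * a * (x * a + c) + (a * a + 1)         ≡⟨ +-assoc _ (a * a) 1 ⟨
    x * a * (x * a + c) + a * a + 1           ≡⟨ h ⟨
    (x * a + c) * (x * a + c)                 ≡⟨ solve (x ∷ a ∷ c ∷ []) ⟩
    x * a * (x * a + c) + (x * c * a + c * c) ∎)

  cassini⁻-unstep : ∀ {a c} → Cassini⁻ x a (x * a + c) → Cassini⁺ x c a
  cassini⁻-unstep {a} {c} h = +-cancelˡ-≡ (x * a * (x * a + c)) _ _ (begin-equality
    x * a * (x * a + c) + a * a                   ≡⟨ h ⟨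
    (x * a + c) * (x * a + c) + 1                 ≡⟨ solve (x ∷ a ∷ c ∷ []) ⟩
    x * a * (x * a + c) + (x * c * a + c * c + 1) ∎)

  U⁺-cassini-even : ∀ k → Cassini⁺ x (U⁺ x (2 * k)) (U⁺ x (suc (2 * k)))
  U⁺-cassini-odd  : ∀ k → Cassini⁻ x (U⁺ x (suc (2 * k))) (U⁺ x (2 + 2 * k))
  U⁺-cassini-even zero = sym (cong (λ t → t * 1 + 0 + 1) (*-zeroʳ x))
  U⁺-cassini-even (suc k) =
    subst (λ i → Cassini⁺ x (U⁺ x i) (U⁺ x (suc i))) (sym (*-suc 2 k)) (cassini⁻-step (U⁺-cassini-odd k))
  U⁺-cassini-odd k = cassini⁺-step (U⁺-cassini-even k)

  cassini⁺-lower : ∀ {a b} → Cassini⁺ x a b → x * a ≤ b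
  cassini⁺-lower {a} {zero} h = ⊥-elim (1+n≢0 (sym (trans h (+-comm _ 1))))
  cassini⁺-lower {a} {b@(suc _)} h = ≮⇒≥ λ b<xa →
    <-irrefl h (<-≤-trans (*-monoˡ-< b b<xa) (≤-trans (m≤m+n _ (a * a)) (m≤m+n _ 1)))

  cassini⁻-lower : ∀ {a b} → 1 ≤ a → 1 ≤ b → Cassini⁻ x a b → x * a ≤ b
  cassini⁻-lower {a@(suc _)} {b@(suc _)} _ _ h = ≮⇒≥ λ b<xa →
    <-irrefl h (≤-<-trans (subst (_≤ x * a * b) (+-comm 1 (b * b)) (*-monoˡ-< b b<xa)) (m<m+n _ z<s))

  cassini⁺-classify : 1 ≤ x → ∀ {a b} → Cassini⁺ x a b →
                      ∃[ k ] a ≡ U⁺ x (2 * k) × b ≡ U⁺ x (suc (2 * k))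
  -- Descent: (a , x a + c) ↦ (c , a) lowers a + b and swaps Cassini⁺ with Cassini⁻.
  cassini⁺-classify x≥1 = descent⁺ _ ≤-refl
    where
    shrink : ∀ {a c f} → 1 ≤ a → a + (x * a + c) ≤ suc f → c + a ≤ f
    shrink {a} {c} a≥1 le = s≤s⁻¹ (<-≤-trans c+a<a+xa+c le)
      where
      c+a<a+xa+c : c + a < a + (x * a + c)
      c+a<a+xa+c = subst (_< a + (x * a + c)) (+-comm a c) (+-monoʳ-< a (m<n+m c (*-mono-≤ x≥1 a≥1)))

    descent⁺ : ∀ fuel {a b} → a + b ≤ fuel → Cassini⁺ x a b →
               ∃[ k ] a ≡ U⁺ x (2 * k) × b ≡ U⁺ x (suc (2 * k))
    descent⁻ : ∀ fuel {a b} → a + b ≤ fuel → 1 ≤ b → Cassini⁻ x a b →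
               ∃[ k ] a ≡ U⁺ x (suc (2 * k)) × b ≡ U⁺ x (2 + 2 * k)
    descent⁺ _ {zero} {b} _ h = 0 , refl , m*n≡1⇒n≡1 b b (trans h (cong (λ t → t * b + 0 + 1) (*-zeroʳ x)))
    descent⁺ zero {suc _} () _
    descent⁺ (suc f) {a@(suc _)} le h with c , refl ← m≤n⇒∃[o]m+o≡n (cassini⁺-lower h)
      with k , c≡ , a≡ ← descent⁻ f (shrink z<s le) z<s (cassini⁺-unstep h) =
      suc k , subst (λ i → a ≡ U⁺ x i × x * a + c ≡ U⁺ x (suc i)) (sym (*-suc 2 k)) (a≡ , cong₂ (λ u v → x * u + v) a≡ c≡)
    descent⁻ _ {zero} {b} _ _ h = ⊥-elim (1+n≢0 (trans (+-comm 1 (b * b)) (trans h (cong (λ t → t * b + 0) (*-zeroʳ x)))))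
    descent⁻ zero {suc _} () _ _
    descent⁻ (suc f) {a@(suc _)} le b≥1 h with c , refl ← m≤n⇒∃[o]m+o≡n (cassini⁻-lower z<s b≥1 h)
      with k , c≡ , a≡ ← descent⁺ f (shrink z<s le) (cassini⁻-unstep h) =
      k , a≡ , cong₂ (λ u v → x * u + v) a≡ c≡

  double-step : ∀ a b → 2 * (x * a + b) ≡ x * (2 * a) + 2 * b
  double-step a b = solve (x ∷ a ∷ b ∷ [])

  V⁺-suc : ∀ n → V⁺ x (suc n) ≡ x * U⁺ x (suc n) + 2 * U⁺ x n
  V⁺-suc zero          = begin-equality x ≡⟨ solve (x ∷ []) ⟩ x * 1 + 2 * 0 ∎
  V⁺-suc (suc zero)    = begin-equality x * x + 2 ≡⟨ solve (x ∷ []) ⟩ x * (x * 1 + 0) + 2 * 1 ∎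
  V⁺-suc (suc (suc n)) = begin-equality
    x * V⁺ x (2 + n) + V⁺ x (suc n)
      ≡⟨ cong₂ (λ u v → x * u + v) (V⁺-suc (suc n)) (V⁺-suc n) ⟩
    x * (x * U⁺ x (2 + n) + 2 * U⁺ x (suc n)) + (x * U⁺ x (suc n) + 2 * U⁺ x n)
      ≡⟨ regroup (U⁺ x (2 + n)) (U⁺ x (suc n)) (U⁺ x n) ⟩
    x * U⁺ x (3 + n) + 2 * U⁺ x (2 + n) ∎
    where
    regroup : ∀ a b c → x * (x * a + 2 * b) + (x * b + 2 * c) ≡ x * (x * a + b) + 2 * (x * b + c)
    regroup a b c = solve (x ∷ a ∷ b ∷ c ∷ [])

  2*V⁺-suc : ∀ n → 2 * V⁺ x (suc n) ≡ x * V⁺ x n + Δ x * U⁺ x n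
  2*V⁺-suc zero          = begin-equality 2 * x ≡⟨ solve (x ∷ []) ⟩ x * 2 + (x * x + 4) * 0 ∎
  2*V⁺-suc (suc zero)    = begin-equality 2 * (x * x + 2) ≡⟨ solve (x ∷ []) ⟩ x * x + (x * x + 4) * 1 ∎
  2*V⁺-suc (suc (suc n)) = begin-equality
    2 * (x * V⁺ x (2 + n) + V⁺ x (suc n))
      ≡⟨ double-step (V⁺ x (2 + n)) (V⁺ x (suc n)) ⟩
    x * (2 * V⁺ x (2 + n)) + 2 * V⁺ x (suc n)
      ≡⟨ cong₂ (λ u v → x * u + v) (2*V⁺-suc (suc n)) (2*V⁺-suc n) ⟩
    x * (x * V⁺ x (suc n) + Δ x * U⁺ x (suc n)) + (x * V⁺ x n + Δ x * U⁺ x n)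
      ≡⟨ regroup (V⁺ x (suc n)) (V⁺ x n) (U⁺ x (suc n)) (U⁺ x n) ⟩
    x * V⁺ x (2 + n) + Δ x * U⁺ x (2 + n) ∎
    where
    regroup : ∀ a b c d → x * (x * a + (x * x + 4) * c) + (x * b + (x * x + 4) * d)
                        ≡ x * (x * a + b) + (x * x + 4) * (x * c + d)
    regroup a b c d = solve (x ∷ a ∷ b ∷ c ∷ d ∷ [])

  2*V⁺-+ : ∀ i j → 2 * V⁺ x (i + j) ≡ V⁺ x i * V⁺ x j + Δ x * U⁺ x i * U⁺ x j
  2*V⁺-+ zero j = sym (trans (cong (λ t → 2 * V⁺ x j + t * U⁺ x j) (*-zeroʳ (Δ x))) (+-identityʳ _))
  2*V⁺-+ (suc zero) j = trans (2*V⁺-suc j) (cong (λ t → x * V⁺ x j + t * U⁺ x j) (sym (*-identityʳ (Δ x))))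
  2*V⁺-+ (suc (suc i)) j = begin-equality
    2 * (x * V⁺ x (suc i + j) + V⁺ x (i + j))
      ≡⟨ double-step (V⁺ x (suc i + j)) (V⁺ x (i + j)) ⟩
    x * (2 * V⁺ x (suc i + j)) + 2 * V⁺ x (i + j)
      ≡⟨ cong₂ (λ u v → x * u + v) (2*V⁺-+ (suc i) j) (2*V⁺-+ i j) ⟩
    x * (V⁺ x (suc i) * V⁺ x j + Δ x * U⁺ x (suc i) * U⁺ x j) + (V⁺ x i * V⁺ x j + Δ x * U⁺ x i * U⁺ x j)
      ≡⟨ regroup (V⁺ x (suc i)) (V⁺ x i) (V⁺ x j) (U⁺ x (suc i)) (U⁺ x i) (U⁺ x j) ⟩
    V⁺ x (2 + i) * V⁺ x j + Δ x * U⁺ x (2 + i) * U⁺ x j ∎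
    where
    regroup : ∀ a b v c d u → x * (a * v + (x * x + 4) * c * u) + (b * v + (x * x + 4) * d * u)
                            ≡ (x * a + b) * v + (x * x + 4) * (x * c + d) * u
    regroup a b v c d u = solve (x ∷ a ∷ b ∷ v ∷ c ∷ d ∷ u ∷ [])

  V⁺-even-sq : ∀ m → V⁺ x (2 * m) * V⁺ x (2 * m) ≡ Δ x * (U⁺ x (2 * m) * U⁺ x (2 * m)) + 4
  V⁺-even-sq zero = cong (_+ 4) (sym (*-zeroʳ (Δ x)))
  V⁺-even-sq (suc k) = subst (λ i → V⁺ x i * V⁺ x i ≡ Δ x * (U⁺ x i * U⁺ x i) + 4) (sym (*-suc 2 k)) (begin-equality
    V⁺ x (2 + 2 * k) * V⁺ x (2 + 2 * k)         ≡⟨ cong (λ v → v * v) (V⁺-suc (suc (2 * k))) ⟩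
    (x * A + 2 * B) * (x * A + 2 * B)           ≡⟨ expand A B ⟩
    x * x * (A * A) + 4 * (x * B * A + B * B)   ≡⟨ cong (λ t → x * x * (A * A) + 4 * t) (U⁺-cassini-odd k) ⟨
    x * x * (A * A) + 4 * (A * A + 1)           ≡⟨ collect A ⟩
    Δ x * (A * A) + 4                           ∎)
    where
    A = U⁺ x (2 + 2 * k)
    B = U⁺ x (suc (2 * k))
    expand : ∀ a b → (x * a + 2 * b) * (x * a + 2 * b) ≡ x * x * (a * a) + 4 * (x * b * a + b * b)
    expand a b = solve (x ∷ a ∷ b ∷ [])
    collect : ∀ a → x * x * (a * a) + 4 * (a * a + 1) ≡ (x * x + 4) * (a * a) + 4
    collect a = solve (x ∷ a ∷ [])

  V⁺-even-≥2 : ∀ m → 2 ≤ V⁺ x (2 * m)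
  V⁺-even-≥2 zero    = ≤-refl
  V⁺-even-≥2 (suc k) = subst (λ i → 2 ≤ V⁺ x i) (sym (*-suc 2 k))
    (≤-trans (V⁺-even-≥2 k) (m≤n+m _ (x * V⁺ x (suc (2 * k)))))

  pell-lower : ∀ {p w} → p * p + 4 ≡ Δ x * (w * w) → x * w ≤ p
  pell-lower {p} {zero} h = ⊥-elim (m+1+n≢0 (p * p) (trans h (*-zeroʳ (Δ x))))
  pell-lower {p} {w@(suc _)} h = ≮⇒≥ λ p<xw → <-irrefl h (<-≤-trans
    (+-monoˡ-< 4 (*-mono-< p<xw p<xw))
    (≤-trans (+-monoʳ-≤ (x * w * (x * w)) (*-monoʳ-≤ 4 (*-mono-≤ {1} {w} z<s z<s))) (≤-reflexive (collect w))))
    where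
    collect : ∀ w → x * w * (x * w) + 4 * (w * w) ≡ (x * x + 4) * (w * w)
    collect w = solve (x ∷ w ∷ [])

  pell-halve : ∀ {w z} → (x * w + z * 2) * (x * w + z * 2) + 4 ≡ Δ x * (w * w) → Cassini⁺ x z w
  pell-halve {w} {z} h = *-cancelˡ-≡ _ _ 4 (+-cancelˡ-≡ (x * w * (x * w)) _ _ (begin-equality
    x * w * (x * w) + 4 * (w * w)                 ≡⟨ solve (x ∷ w ∷ []) ⟩
    (x * x + 4) * (w * w)                         ≡⟨ h ⟨
    (x * w + z * 2) * (x * w + z * 2) + 4         ≡⟨ solve (x ∷ w ∷ z ∷ []) ⟩
    x * w * (x * w) + 4 * (x * z * w + z * z + 1) ∎))

  pell-parity : ∀ {w y} → (x * w + y) * (x * w + y) + 4 ≡ Δ x * (w * w) → 2 ∣ y * y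
  pell-parity {w} {y} h = ∣m+n∣m⇒∣n (subst (2 ∣_) 4w²≡ (m∣m*n (2 * (w * w)))) (m∣m*n (x * w * y + 2))
    where
    4w²≡ : 2 * (2 * (w * w)) ≡ 2 * (x * w * y + 2) + y * y
    4w²≡ = +-cancelˡ-≡ (x * w * (x * w)) _ _ (begin-equality
      x * w * (x * w) + 2 * (2 * (w * w))             ≡⟨ solve (x ∷ w ∷ []) ⟩
      (x * x + 4) * (w * w)                           ≡⟨ h ⟨
      (x * w + y) * (x * w + y) + 4                   ≡⟨ solve (x ∷ w ∷ y ∷ []) ⟩
      x * w * (x * w) + (2 * (x * w * y + 2) + y * y) ∎)

  -- Writing p = x w + y, the equation forces y = 2 z with (z , w) a solution of Cassini⁺.
  pell-classify : 1 ≤ x → ∀ {p w} → p * p + 4 ≡ Δ x * (w * w) →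
                  ∃[ k ] p ≡ V⁺ x (suc (2 * k)) × w ≡ U⁺ x (suc (2 * k))
  pell-classify x≥1 {p} {w} h with y , refl ← m≤n⇒∃[o]m+o≡n (pell-lower {p} {w} h)
    with divides z refl ← even-square⇒even {y} (pell-parity h)
    with k , z≡ , w≡ ← cassini⁺-classify x≥1 (pell-halve {w} {z} h) =
    k , (begin-equality
      x * w + z * 2                                ≡⟨ cong₂ (λ u v → x * u + v * 2) w≡ z≡ ⟩
      x * U⁺ x (suc (2 * k)) + U⁺ x (2 * k) * 2    ≡⟨ cong (λ t → x * U⁺ x (suc (2 * k)) + t) (*-comm (U⁺ x (2 * k)) 2) ⟩
      x * U⁺ x (suc (2 * k)) + 2 * U⁺ x (2 * k)    ≡⟨ V⁺-suc (2 * k) ⟨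
      V⁺ x (suc (2 * k))                           ∎) , w≡

  V⁺-shift : ∀ {q} m i → 2 * q ≡ V⁺ x (2 * m) * V⁺ x i + Δ x * U⁺ x (2 * m) * U⁺ x i → q ≡ V⁺ x (i + 2 * m)
  V⁺-shift {q} m i 2q≡ = *-cancelˡ-≡ q (V⁺ x (i + 2 * m)) 2 (begin-equality
    2 * q                                                       ≡⟨ 2q≡ ⟩
    V⁺ x (2 * m) * V⁺ x i + Δ x * U⁺ x (2 * m) * U⁺ x i         ≡⟨ swap (V⁺ x (2 * m)) (V⁺ x i) (U⁺ x (2 * m)) (U⁺ x i) ⟩
    V⁺ x i * V⁺ x (2 * m) + Δ x * U⁺ x i * U⁺ x (2 * m)         ≡⟨ 2*V⁺-+ i (2 * m) ⟨
    2 * V⁺ x (i + 2 * m)                                        ∎)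
    where
    swap : ∀ a b c d → a * b + (x * x + 4) * c * d ≡ b * a + (x * x + 4) * d * c
    swap a b c d = solve (x ∷ a ∷ b ∷ c ∷ d ∷ [])

  semiprime-discriminant : ∀ m {p q} → p < q →
    p * p + q * q + 4 ≡ V⁺ x (2 * m) * (p * q) + V⁺ x (2 * m) * V⁺ x (2 * m) →
    ∃[ s ] s ≢ 0 × 2 * q ≡ V⁺ x (2 * m) * p + s × s * s ≡ Δ x * (U⁺ x (2 * m) * U⁺ x (2 * m)) * (p * p + 4)
  semiprime-discriminant m {p} {q} p<q eq = s , m>n⇒m∸n≢0 ap<2q , 2q≡ ,
    discriminant {V⁺ x (2 * m)} {p} {q} {s} eq 2q≡ (V⁺-even-sq m)
    where
    ap<2q = other-root-large {V⁺ x (2 * m)} {p} {q} (V⁺-even-≥2 m) p<q eq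
    s = 2 * q ∸ V⁺ x (2 * m) * p
    2q≡ : 2 * q ≡ V⁺ x (2 * m) * p + s
    2q≡ = sym (m+[n∸m]≡n (<⇒≤ ap<2q))

  -- The discriminant (a² - 4)(p² + 4) must be a square, which for square-free D = x² + 4
  -- forces p² + 4 = D w² and hence p = V_{2k+1}.
  semiprime-classify : 1 ≤ x → SquareFree (Δ x) → ∀ m {p q} → p < q →
    p * p + q * q + 4 ≡ V⁺ x (2 * m) * (p * q) + V⁺ x (2 * m) * V⁺ x (2 * m) →
    ∃[ k ] p ≡ V⁺ x (2 * k + 1) × q ≡ V⁺ x (2 * k + 2 * m + 1)
  semiprime-classify x≥1 sf m {p} {q} p<q eq = via-discriminant (semiprime-discriminant m {p} {q} p<q eq)
    where
    via-discriminant : ∃[ s ] s ≢ 0 × 2 * q ≡ V⁺ x (2 * m) * p + s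
                               × s * s ≡ Δ x * (U⁺ x (2 * m) * U⁺ x (2 * m)) * (p * p + 4) →
                       ∃[ k ] p ≡ V⁺ x (2 * k + 1) × q ≡ V⁺ x (2 * k + 2 * m + 1)
    via-discriminant (s , s≢0 , 2q≡ , s²≡) = via-pell (squareFree-sq-split {Δ x} {U⁺ x (2 * m)} {p * p + 4} sf {s} s≢0 s²≡)
      where
      via-pell : ∃[ w ] p * p + 4 ≡ Δ x * (w * w) × s ≡ Δ x * U⁺ x (2 * m) * w →
                 ∃[ k ] p ≡ V⁺ x (2 * k + 1) × q ≡ V⁺ x (2 * k + 2 * m + 1)
      via-pell (w , p²+4≡ , s≡) with k , p≡ , w≡ ← pell-classify x≥1 {p} {w} p²+4≡ =
        k , trans p≡ (cong (V⁺ x) (+-comm 1 (2 * k))) ,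
        trans (V⁺-shift {q} m (suc (2 * k)) (trans 2q≡ (cong₂ (λ u v → V⁺ x (2 * m) * u + v) p≡
                (trans s≡ (cong (Δ x * U⁺ x (2 * m) *_) w≡)))))
              (cong (V⁺ x) (sym (+-comm (2 * k + 2 * m) 1)))

divisorSquares : ℕ → List ℕ → ℕ
divisorSquares n ds = sum (map (λ d → d * d) (filter (λ d → d ∣? n) ds))

-- σ₂≤ n N is the part of σ₂ n coming from the divisors d ≤ N, so σ₂ n = σ₂≤ n n.
σ₂≤ : ℕ → ℕ → ℕ
σ₂≤ n N = divisorSquares n (map suc (upTo N))

divisorSquares-++ : ∀ n ds es → divisorSquares n (ds ++ es) ≡ divisorSquares n ds + divisorSquares n es
divisorSquares-++ n ds es = begin-equality
  sum (map sq (filter (_∣? n) (ds ++ es)))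
    ≡⟨ cong (sum ∘ map sq) (filter-++ (_∣? n) ds es) ⟩
  sum (map sq (filter (_∣? n) ds ++ filter (_∣? n) es))
    ≡⟨ cong sum (map-++ sq (filter (_∣? n) ds) (filter (_∣? n) es)) ⟩
  sum (map sq (filter (_∣? n) ds) ++ map sq (filter (_∣? n) es))
    ≡⟨ sum-++ (map sq (filter (_∣? n) ds)) (map sq (filter (_∣? n) es)) ⟩
  divisorSquares n ds + divisorSquares n es ∎
  where
  sq : ℕ → ℕ
  sq d = d * d

σ₂≤-suc : ∀ n N → σ₂≤ n (suc N) ≡ σ₂≤ n N + divisorSquares n [ suc N ]
σ₂≤-suc n N = begin-equality
  divisorSquares n (map suc (upTo (suc N)))            ≡⟨ cong (divisorSquares n ∘ map suc) (upTo-∷ʳ N) ⟨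
  divisorSquares n (map suc (upTo N ∷ʳ N))             ≡⟨ cong (divisorSquares n) (map-++ suc (upTo N) [ N ]) ⟩
  divisorSquares n (map suc (upTo N) ++ [ suc N ])     ≡⟨ divisorSquares-++ n (map suc (upTo N)) [ suc N ] ⟩
  σ₂≤ n N + divisorSquares n [ suc N ]                 ∎

σ₂≤-suc-∣ : ∀ {n N} → suc N ∣ n → σ₂≤ n (suc N) ≡ σ₂≤ n N + suc N * suc N
σ₂≤-suc-∣ {n} {N} d∣n = begin-equality
  σ₂≤ n (suc N)                                  ≡⟨ σ₂≤-suc n N ⟩
  σ₂≤ n N + divisorSquares n [ suc N ]           ≡⟨ cong (λ ds → σ₂≤ n N + sum (map (λ d → d * d) ds))
                                                          (filter-accept (_∣? n) d∣n) ⟩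
  σ₂≤ n N + (suc N * suc N + 0)                  ≡⟨ cong (λ t → σ₂≤ n N + t) (+-identityʳ _) ⟩
  σ₂≤ n N + suc N * suc N                        ∎

σ₂≤-suc-∤ : ∀ {n N} → ¬ suc N ∣ n → σ₂≤ n (suc N) ≡ σ₂≤ n N
σ₂≤-suc-∤ {n} {N} d∤n = begin-equality
  σ₂≤ n (suc N)                                  ≡⟨ σ₂≤-suc n N ⟩
  σ₂≤ n N + divisorSquares n [ suc N ]           ≡⟨ cong (λ ds → σ₂≤ n N + sum (map (λ d → d * d) ds))
                                                          (filter-reject (_∣? n) d∤n) ⟩
  σ₂≤ n N + 0                                    ≡⟨ +-identityʳ _ ⟩
  σ₂≤ n N                                        ∎

σ₂≤-mono : ∀ n {M N} → M ≤ N → σ₂≤ n M ≤ σ₂≤ n N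
σ₂≤-mono n {N = zero} z≤n = ≤-refl
σ₂≤-mono n {M} {suc N} M≤1+N with m≤n⇒m<n∨m≡n M≤1+N
... | inj₂ refl = ≤-refl
... | inj₁ M<1+N = ≤-trans (σ₂≤-mono n (s≤s⁻¹ M<1+N)) step
  where
  step : σ₂≤ n N ≤ σ₂≤ n (suc N)
  step with suc N ∣? n
  ... | yes d∣n = ≤-trans (m≤m+n _ _) (≤-reflexive (sym (σ₂≤-suc-∣ d∣n)))
  ... | no  d∤n = ≤-reflexive (sym (σ₂≤-suc-∤ d∤n))

σ₂≤-gap : ∀ {n M N} → M ≤ N → (∀ {z} → z ∣ n → M < z → N < z) → σ₂≤ n N ≡ σ₂≤ n M
σ₂≤-gap {N = zero} z≤n _ = refl
σ₂≤-gap {n} {M} {suc N} M≤1+N gap with m≤n⇒m<n∨m≡n M≤1+N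
... | inj₂ refl = refl
... | inj₁ M<1+N = trans (σ₂≤-suc-∤ λ d∣n → <-irrefl refl (gap d∣n M<1+N))
                         (σ₂≤-gap (s≤s⁻¹ M<1+N) λ z∣n M<z → <-trans (n<1+n N) (gap z∣n M<z))

σ₂≤-jump : ∀ {n M y} → M < y → y ∣ n → (∀ {z} → z ∣ n → M < z → y ≤ z) → σ₂≤ n y ≡ σ₂≤ n M + y * y
σ₂≤-jump {n} {M} {suc N} M<y y∣n gap =
  trans (σ₂≤-suc-∣ y∣n) (cong (_+ suc N * suc N) (σ₂≤-gap (s≤s⁻¹ M<y) gap))

σ₂≤-1 : ∀ n → σ₂≤ n 1 ≡ 1
σ₂≤-1 n = σ₂≤-suc-∣ (divides n (sym (*-identityʳ n)))

σ₂-lower : ∀ {n e} → e ∣ n → 1 < e → e < n → 1 + e * e + n * n ≤ σ₂ n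
σ₂-lower {n@(suc n′)} {e@(suc e′)} e∣n 1<e e<n = begin
  1 + e * e + n * n              ≡⟨ cong (λ t → t + e * e + n * n) (σ₂≤-1 n) ⟨
  σ₂≤ n 1 + e * e + n * n        ≤⟨ +-monoˡ-≤ (n * n) (+-monoˡ-≤ (e * e) (σ₂≤-mono n (s≤s⁻¹ 1<e))) ⟩
  σ₂≤ n e′ + e * e + n * n       ≡⟨ cong (_+ n * n) (σ₂≤-suc-∣ e∣n) ⟨
  σ₂≤ n e + n * n                ≤⟨ +-monoˡ-≤ (n * n) (σ₂≤-mono n (s≤s⁻¹ e<n)) ⟩
  σ₂≤ n n′ + n * n               ≡⟨ σ₂≤-suc-∣ {n} {n′} ∣-refl ⟨
  σ₂ n                           ∎

prime>1 : ∀ {p} → Prime p → 1 < p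
prime>1 {p} pp = nonTrivial⇒n>1 p {{prime⇒nonTrivial pp}}

σ₂-prime : ∀ {p} → Prime p → σ₂ p ≡ 1 + p * p
σ₂-prime {p} pp = trans (σ₂≤-jump (prime>1 pp) ∣-refl gap) (cong (_+ p * p) (σ₂≤-1 p))
  where
  gap : ∀ {z} → z ∣ p → 1 < z → p ≤ z
  gap z∣p 1<z with prime⇒irreducible pp z∣p
  ... | inj₁ refl = ⊥-elim (<-irrefl refl 1<z)
  ... | inj₂ refl = ≤-refl

semiprime-divisor : ∀ {p q z} → Prime p → Prime q → z ∣ p * q → z ≡ 1 ⊎ z ≡ p ⊎ z ≡ q ⊎ z ≡ p * q
semiprime-divisor {p} {q} {z} pp pq z∣pq with p ∣? z
... | yes (divides t refl)
  with prime⇒irreducible pq {t} (*-cancelʳ-∣ p {{prime⇒nonZero pp}} (subst (t * p ∣_) (*-comm p q) z∣pq))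
...   | inj₁ refl = inj₂ (inj₁ (*-identityˡ p))
...   | inj₂ refl = inj₂ (inj₂ (inj₂ (*-comm q p)))
semiprime-divisor {p} {q} {z} pp pq z∣pq | no p∤z with prime⇒irreducible pq {z} (coprime-divisor z⊥p z∣pq)
  where
  z⊥p : Coprime z p
  z⊥p (i∣z , i∣p) with prime⇒irreducible pp i∣p
  ... | inj₁ i≡1 = i≡1
  ... | inj₂ refl = ⊥-elim (p∤z i∣z)
... | inj₁ z≡1 = inj₁ z≡1
... | inj₂ z≡q = inj₂ (inj₂ (inj₁ z≡q))

module _ {p q} (pp : Prime p) (pq : Prime q) (p≤q : p ≤ q) where

  private
    1<p : 1 < p
    1<p = prime>1 pp
    q<pq : q < p * q
    q<pq = subst (q <_) (*-comm q p) (m<m*n q p {{prime⇒nonZero pq}} 1<p)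

  semiprime-gap-1 : ∀ {z} → z ∣ p * q → 1 < z → p ≤ z
  semiprime-gap-1 z∣pq 1<z with semiprime-divisor pp pq z∣pq
  ... | inj₁ refl                 = ⊥-elim (<-irrefl refl 1<z)
  ... | inj₂ (inj₁ refl)          = ≤-refl
  ... | inj₂ (inj₂ (inj₁ refl))   = p≤q
  ... | inj₂ (inj₂ (inj₂ refl))   = ≤-trans p≤q (<⇒≤ q<pq)

  semiprime-gap-p : ∀ {z} → z ∣ p * q → p < z → q ≤ z
  semiprime-gap-p z∣pq p<z with semiprime-divisor pp pq z∣pq
  ... | inj₁ refl                 = ⊥-elim (<-asym 1<p p<z)
  ... | inj₂ (inj₁ refl)          = ⊥-elim (<-irrefl refl p<z)
  ... | inj₂ (inj₂ (inj₁ refl))   = ≤-refl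
  ... | inj₂ (inj₂ (inj₂ refl))   = <⇒≤ q<pq

  semiprime-gap-q : ∀ {z} → z ∣ p * q → q < z → p * q ≤ z
  semiprime-gap-q z∣pq q<z with semiprime-divisor pp pq z∣pq
  ... | inj₁ refl                 = ⊥-elim (<-asym (<-≤-trans 1<p p≤q) q<z)
  ... | inj₂ (inj₁ refl)          = ⊥-elim (<⇒≱ q<z p≤q)
  ... | inj₂ (inj₂ (inj₁ refl))   = ⊥-elim (<-irrefl refl q<z)
  ... | inj₂ (inj₂ (inj₂ refl))   = ≤-refl

  σ₂-semiprime-top : σ₂ (p * q) ≡ σ₂≤ (p * q) q + p * q * (p * q)
  σ₂-semiprime-top = σ₂≤-jump {p * q} {q} {p * q} q<pq ∣-refl semiprime-gap-q

  σ₂≤-semiprime-p : σ₂≤ (p * q) p ≡ 1 + p * p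
  σ₂≤-semiprime-p = trans (σ₂≤-jump {p * q} {1} {p} 1<p (m∣m*n q) semiprime-gap-1) (cong (_+ p * p) (σ₂≤-1 (p * q)))

σ₂-semiprime : ∀ {p q} → Prime p → Prime q → p < q → σ₂ (p * q) ≡ 1 + p * p + q * q + p * q * (p * q)
σ₂-semiprime {p} {q} pp pq p<q = begin-equality
  σ₂ (p * q)                                 ≡⟨ σ₂-semiprime-top pp pq p≤q ⟩
  σ₂≤ (p * q) q + p * q * (p * q)
    ≡⟨ cong (_+ p * q * (p * q)) (σ₂≤-jump {p * q} {p} {q} p<q (n∣m*n p) (semiprime-gap-p pp pq p≤q)) ⟩
  σ₂≤ (p * q) p + q * q + p * q * (p * q)    ≡⟨ cong (λ t → t + q * q + p * q * (p * q)) (σ₂≤-semiprime-p pp pq p≤q) ⟩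
  1 + p * p + q * q + p * q * (p * q)        ∎
  where
  p≤q = <⇒≤ p<q

σ₂-prime-square : ∀ {p} → Prime p → σ₂ (p * p) ≡ 1 + p * p + p * p * (p * p)
σ₂-prime-square {p} pp = trans (σ₂-semiprime-top pp pp ≤-refl) (cong (_+ p * p * (p * p)) (σ₂≤-semiprime-p pp pp ≤-refl))

least-prime-divisor : ∀ {n} → 1 < n → ∃[ d ] Prime d × d ∣ n × d Rough n
least-prime-divisor {n} 1<n = search (n ∸ 2) (m+[n∸m]≡n 1<n) ≤-refl 2-rough
  where
  found : ∀ {m} → 1 < m → m Rough n → m ∣ n → ∃[ d ] Prime d × d ∣ n × d Rough n
  found {m} 1<m rough m∣n = m , rough∧∣⇒prime {{n>1⇒nonTrivial 1<m}} rough m∣n , m∣n , rough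
  search : ∀ k {m} → m + k ≡ n → 1 < m → m Rough n → ∃[ d ] Prime d × d ∣ n × d Rough n
  search zero {m} m+0≡n 1<m rough = found 1<m rough (∣-reflexive (trans (sym (+-identityʳ m)) m+0≡n))
  search (suc k) {m} m+1+k≡n 1<m rough with m ∣? n
  ... | yes m∣n = found 1<m rough m∣n
  ... | no  m∤n = search k (trans (sym (+-suc m k)) m+1+k≡n) (m<n⇒m<1+n 1<m) (∤⇒rough-suc m∤n rough)

cube-bound : ∀ {t d e} → .{{NonZero d}} → d * d ≤ e → e * e < t * (e * d) → e * d < t ^ 3
cube-bound {t} {d} {e} d²≤e e²<ted = begin-strict
  e * d            <⟨ *-monoˡ-< d e<td ⟩
  t * d * d        ≡⟨ *-assoc t d d ⟩
  t * (d * d)      ≤⟨ *-monoʳ-≤ t (*-mono-≤ (<⇒≤ d<t) (<⇒≤ d<t)) ⟩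
  t * (t * t)      ≡⟨ cong (λ u → t * (t * u)) (*-identityʳ t) ⟨
  t ^ 3            ∎
  where
  e<td : e < t * d
  e<td = *-cancelʳ-< e e (t * d) (subst (e * e <_) (trans (cong (t *_) (*-comm e d)) (sym (*-assoc t d e))) e²<ted)
  d<t : d < t
  d<t = *-cancelʳ-< d d t (≤-<-trans d²≤e e<td)

-- The equation of the theorem for a = V_{2m}, with the subtractions moved across.
IsSolution : ℕ → ℕ → Set
IsSolution a n = σ₂ n + 3 ≡ n * n + (a * n + a * a)

-- (∣V∣ + V² - 3)³ for V = V_{2m}; as V² ≥ 4 the truncated subtraction is exact.
solutionBound : ℕ → ℕ
solutionBound a = (a + a * a ∸ 3) ^ 3

3≤square : ∀ {a} → 2 ≤ a → 3 ≤ a * a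
3≤square 2≤a = ≤-trans (n≤1+n 3) (*-mono-≤ 2≤a 2≤a)

solutionBound>0 : ∀ {a} → 2 ≤ a → 0 < solutionBound a
solutionBound>0 {a} 2≤a = m^n>0 (a + a * a ∸ 3) {{>-nonZero 0<t}} 3
  where
  0<t : 0 < a + a * a ∸ 3
  0<t = <-≤-trans (<-trans z<s 2≤a) (subst (a ≤_) (sym (+-∸-assoc a (3≤square 2≤a))) (m≤m+n a _))

solution-excess : ∀ {a n S} → σ₂ n ≡ S + n * n → IsSolution a n → S + 3 ≡ a * n + a * a
solution-excess {a} {n} {S} σ₂≡ sol = +-cancelˡ-≡ (n * n) _ _ (begin-equality
  n * n + (S + 3)           ≡⟨ solve (n ∷ S ∷ []) ⟩
  S + n * n + 3             ≡⟨ cong (_+ 3) σ₂≡ ⟨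
  σ₂ n + 3                  ≡⟨ sol ⟩
  n * n + (a * n + a * a)   ∎)

prime-not-solution : ∀ {a p} → 2 ≤ a → Prime p → ¬ IsSolution a p
prime-not-solution {a} {p} 2≤a pp sol = <-irrefl (solution-excess {a} {p} {1} (σ₂-prime pp) sol)
  (+-mono-<-≤ (*-mono-≤ (<⇒≤ 2≤a) (<⇒≤ (prime>1 pp))) (*-mono-≤ 2≤a 2≤a))

prime-square-not-solution : ∀ {a p} → 2 ≤ a → Prime p → ¬ IsSolution a (p * p)
prime-square-not-solution {a} {p} 2≤a pp sol = <-irrefl (solution-excess {a} {p * p} {1 + p * p} (σ₂-prime-square pp) sol)
  (begin-strict
    1 + p * p + 3          ≡⟨ solve (p ∷ []) ⟩
    1 * (p * p) + 4        <⟨ +-mono-<-≤ (*-monoˡ-< (p * p) {{m*n≢0 p p}} 2≤a) (*-mono-≤ 2≤a 2≤a) ⟩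
    a * (p * p) + a * a    ∎)
  where instance _ = prime⇒nonZero pp

semiprime-solution : ∀ {a p q} → Prime p → Prime q → p < q → IsSolution a (p * q) →
                     p * p + q * q + 4 ≡ a * (p * q) + a * a
semiprime-solution {a} {p} {q} pp pq p<q sol = begin-equality
  p * p + q * q + 4          ≡⟨ solve (p ∷ q ∷ []) ⟩
  1 + p * p + q * q + 3      ≡⟨ solution-excess {a} {p * q} {1 + p * p + q * q} (σ₂-semiprime pp pq p<q) sol ⟩
  a * (p * q) + a * a        ∎

solution-divisor-bound : ∀ {a n e} → IsSolution a n → e ∣ n → 1 < e → e < n → e * e + 4 ≤ a * n + a * a
solution-divisor-bound {a} {n} {e} sol e∣n 1<e e<n = +-cancelˡ-≤ (n * n) _ _ (begin
  n * n + (e * e + 4)       ≡⟨ solve (n ∷ e ∷ []) ⟩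
  1 + e * e + n * n + 3     ≤⟨ +-monoˡ-≤ 3 (σ₂-lower e∣n 1<e e<n) ⟩
  σ₂ n + 3                  ≡⟨ sol ⟩
  n * n + (a * n + a * a)   ∎)

solution-cofactor-bound : ∀ {a n e} → 2 ≤ a → .{{NonZero n}} → e * e + 4 ≤ a * n + a * a →
                          e * e < (a + a * a ∸ 3) * n
solution-cofactor-bound {a} {n} {e} 2≤a bound = begin-strict
  e * e                    <⟨ +-cancelʳ-≤ 3 (suc (e * e)) (a * n + c) (subst₂ _≤_ (+-suc (e * e) 3) a*n+a*a≡ bound) ⟩
  a * n + c                ≤⟨ +-monoʳ-≤ (a * n) (m≤m*n c n) ⟩
  a * n + c * n            ≡⟨ *-distribʳ-+ n a c ⟨
  (a + c) * n              ≡⟨ cong (_* n) (+-∸-assoc a 3≤a*a) ⟨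
  (a + a * a ∸ 3) * n      ∎
  where
  3≤a*a = 3≤square 2≤a
  c = a * a ∸ 3
  a*n+a*a≡ : a * n + a * a ≡ a * n + c + 3
  a*n+a*a≡ = trans (cong (λ t → a * n + t) (trans (sym (m+[n∸m]≡n 3≤a*a)) (+-comm 3 c))) (sym (+-assoc (a * n) c 3))

DistinctPrimeProduct : ℕ → Set
DistinctPrimeProduct n = ∃[ p ] ∃[ q ] p < q × Prime p × Prime q × n ≡ p * q

large-solution-semiprime : ∀ {a n} → 2 ≤ a → IsSolution a n → solutionBound a < n → DistinctPrimeProduct n
large-solution-semiprime {a} {n} 2≤a sol T<n
  with d , pd , divides e refl , rough ← least-prime-divisor (≤-<-trans (solutionBound>0 2≤a) T<n)
  = cofactor e rough sol T<n
  where
  cofactor : ∀ e → d Rough (e * d) → IsSolution a (e * d) → solutionBound a < e * d → DistinctPrimeProduct (e * d)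
  cofactor 0 _ _ T<0 = ⊥-elim (n≮0 T<0)
  cofactor 1 _ sol _ = ⊥-elim (prime-not-solution 2≤a pd (subst (IsSolution a) (*-identityˡ d) sol))
  cofactor e@(suc (suc _)) rough sol T<n with d * d ≤? e
  ... | yes d²≤e = ⊥-elim (<-asym T<n (cube-bound {a + a * a ∸ 3} {{prime⇒nonZero pd}} d²≤e
          (solution-cofactor-bound {a} {e * d} {e} 2≤a {{m*n≢0 e d {{_}} {{prime⇒nonZero pd}}}}
            (solution-divisor-bound {a} {e * d} {e} sol (m∣m*n d) sz<ss (m<m*n e d (prime>1 pd))))))
  ... | no d²≰e with m≤n⇒m<n∨m≡n (rough⇒≤ (rough∧∣⇒rough rough (m∣m*n d)))
  ...   | inj₁ d<e  = d , e , d<e , pd , rough∧square>⇒prime (rough∧∣⇒rough rough (m∣m*n d)) (≰⇒> d²≰e) , *-comm e d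
  ...   | inj₂ refl = ⊥-elim (prime-square-not-solution 2≤a pd sol)

squareFree-Δ⇒≥1 : ∀ {x} → SquareFree (Δ x) → 1 ≤ x
squareFree-Δ⇒≥1 {zero} sf with sf 2 (divides 1 refl)
... | ()
squareFree-Δ⇒≥1 {suc x} _ = s≤s z≤n

LucasPrimeProduct : ℕ → ℕ → ℕ → Set
LucasPrimeProduct x m n =
  ∃[ k ] n ≡ V⁺ x (2 * k + 1) * V⁺ x (2 * k + 2 * m + 1) × Prime (V⁺ x (2 * k + 1)) × Prime (V⁺ x (2 * k + 2 * m + 1))

solution-classify : ∀ {x} → SquareFree (Δ x) → ∀ m {n} → IsSolution (V⁺ x (2 * m)) n →
                    n ≤ solutionBound (V⁺ x (2 * m)) ⊎ LucasPrimeProduct x m n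
solution-classify {x} sf m {n} sol with n ≤? solutionBound (V⁺ x (2 * m))
... | yes n≤T = inj₁ n≤T
... | no  n≰T = inj₂ (lucas (large-solution-semiprime {a} {n} (V⁺-even-≥2 x m) sol (≰⇒> n≰T)))
  where
  a = V⁺ x (2 * m)
  x≥1 = squareFree-Δ⇒≥1 sf
  lucas : DistinctPrimeProduct n → LucasPrimeProduct x m n
  lucas (p , q , p<q , pp , pq , n≡pq) =
    indices (semiprime-classify x x≥1 sf m {p} {q} p<q
              (semiprime-solution {a} {p} {q} pp pq p<q (subst (IsSolution a) n≡pq sol)))
    where
    indices : ∃[ k ] p ≡ V⁺ x (2 * k + 1) × q ≡ V⁺ x (2 * k + 2 * m + 1) → LucasPrimeProduct x m n
    indices (k , p≡ , q≡) = k , trans n≡pq (cong₂ _*_ p≡ q≡) , subst Prime p≡ pp , subst Prime q≡ pq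

theorem1p5 : (P : ℤ) → SquareFreeℤ (P ℤ.* P ℤ.+ + 4) → (m : ℕ) → (n : ℕ) → 0 ℕ.< n →
    (+ σ₂ n ℤ.- + (n ℕ.* n) ≡ V P -[1+ 0 ] (2 ℕ.* m) ℤ.* + n ℤ.+ V P -[1+ 0 ] (2 ℕ.* m) ℤ.* V P -[1+ 0 ] (2 ℕ.* m) ℤ.- + 3) →
    (+ n ℤ.≤ (+ ∣ V P -[1+ 0 ] (2 ℕ.* m) ∣ ℤ.+ V P -[1+ 0 ] (2 ℕ.* m) ℤ.* V P -[1+ 0 ] (2 ℕ.* m) ℤ.- + 3) ℤ.^ 3)
    ⊎ (Σ ℕ (λ k → (+ n ≡ V P -[1+ 0 ] (2 ℕ.* k ℕ.+ 1) ℤ.* V P -[1+ 0 ] (2 ℕ.* k ℕ.+ 2 ℕ.* m ℕ.+ 1))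
        × Prime ∣ V P -[1+ 0 ] (2 ℕ.* k ℕ.+ 1) ∣ × Prime ∣ V P -[1+ 0 ] (2 ℕ.* k ℕ.+ 2 ℕ.* m ℕ.+ 1) ∣))
    ⊎ (Σ ℕ (λ k → (2 ℕ.* k ℕ.+ 1 ℕ.≤ 2 ℕ.* m) × (m ≢ 2 ℕ.* k ℕ.+ 1)
        × (+ n ≡ V P -[1+ 0 ] (2 ℕ.* k ℕ.+ 1) ℤ.* V P -[1+ 0 ] (2 ℕ.* m ℕ.∸ (2 ℕ.* k ℕ.+ 1)))
        × Prime ∣ V P -[1+ 0 ] (2 ℕ.* k ℕ.+ 1) ∣ × Prime ∣ V P -[1+ 0 ] (2 ℕ.* m ℕ.∸ (2 ℕ.* k ℕ.+ 1)) ∣))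
theorem1p5 P sf m n _ eq rewrite V-even P m
  with solution-classify (squareFreeℤ⇒squareFree-Δ P sf) m (equation-to-ℕ {V⁺ ∣ P ∣ (2 * m)} {n} eq)
... | inj₁ n≤bound = inj₁ (bound-to-ℤ {V⁺ ∣ P ∣ (2 * m)} {n} (V⁺-even-≥2 ∣ P ∣ m) n≤bound)
... | inj₂ (k , n≡ , prime₁ , prime₂) = inj₂ (inj₁ (k ,
      trans (cong +_ n≡) (sym (V-even-product P {2 * k + 1} {2 * k + 2 * m + 1} {2 * k + m + 1} (index-sum k m))) ,
      subst Prime (sym (∣V∣ P (2 * k + 1))) prime₁ , subst Prime (sym (∣V∣ P (2 * k + 2 * m + 1))) prime₂))
  where
  index-sum : ∀ k m → 2 * k + 1 + (2 * k + 2 * m + 1) ≡ 2 * (2 * k + m + 1)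
  index-sum = solve-∀
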